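{- Let $1\le k<n$, let $A\subset[n]$ with $|A|=k$, and let $I\subset[n]\setminus A$. Fix the first $k$ rows $M_k$ of $M_n$ and let the row $k+1$ be random. Then $$\mathbb{P}\left(|\mathrm{Per}(M_{A\cup\{i\}})|\ge|\mathrm{Per}(M_A)| \text{ for some } i\in I\right)\ge 1-2^{ -|I|}$$ and $$\mathbb{P}\left(|\mathrm{Per}(M_{A\cup\{i\}})|\ge|\mathrm{Per}(M_A)| \text{ for at least } |I|/3 \text{ values of } i\in I\right)\ge 1-O(\exp(-\Omega(|I|))),$$ with absolute implied constants.
   Context: $M_n=(a_{ij})$ is an $n\times n$ random matrix with independent entries, each uniform on $\{ -1,+1\}$; $M_k$ denotes the $k\times n$ matrix formed by its first $k$ rows. For a $k$-element set $A\subset [n]$, $M_A$ denotes the $k\times k$ submatrix of $M_n$ formed by the first $k$ rows and the columns indexed by $A$ (so $M_{A\cup\{i\}}$ uses the first $k+1$ rows). $\mathrm{Per}$ is the permanent $\mathrm{Per}(M)=\sum_{\sigma}\prod_i a_{i\sigma(i)}$. -}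

module Defs where

open import Data.Bool using (Bool; true; false)
open import Data.Nat using (ℕ; zero; suc)
open import Data.Integer using (ℤ; +_; -[1+_]; _+_; _*_; ∣_∣)
open import Data.Fin using (Fin; zero; suc; fromℕ; _<_)
open import Data.Fin.Properties using (all?; _≟_)
open import Data.Fin.Subset using (Subset; _∈_)
open import Data.Fin.Subset.Properties using (_∈?_)
open import Data.List using (List; []; _∷_; map; concatMap; filter; foldr; length; allFin)
open import Data.Product using (_×_)
open import Relation.Binary.PropositionalEquality using (_≡_)
open import Relation.Nullary.Decidable using (Dec; _→-dec_; _×-dec_)
open import Data.Nat using (_≤_) renaming (_≤?_ to _≤ℕ?_)

sgn : Bool → ℤ
sgn true  = + 1
sgn false = -[1+ 0 ]

allFuns : {X : Set} → (m : ℕ) → List X → List (Fin m → X)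
allFuns zero    xs = (λ ()) ∷ []
allFuns (suc m) xs =
  concatMap (λ x → map (λ f → λ { zero → x ; (suc i) → f i }) (allFuns m xs)) xs

allRows : (n : ℕ) → List (Fin n → Bool)
allRows n = allFuns n (true ∷ false ∷ [])

IsPerm : {m : ℕ} → (Fin m → Fin m) → Set
IsPerm σ = ∀ i j → σ i ≡ σ j → i ≡ j

isPerm? : {m : ℕ} → (σ : Fin m → Fin m) → Dec (IsPerm σ)
isPerm? σ = all? (λ i → all? (λ j → (σ i ≟ σ j) →-dec (i ≟ j)))

perms : (m : ℕ) → List (Fin m → Fin m)
perms m = filter isPerm? (allFuns m (allFin m))

sumℤ : List ℤ → ℤ
sumℤ = foldr _+_ (+ 0)

prodℤ : List ℤ → ℤ
prodℤ = foldr _*_ (+ 1)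

Per : {m : ℕ} → (Fin m → Fin m → ℤ) → ℤ
Per {m} M = sumℤ (map (λ σ → prodℤ (map (λ i → M i (σ i)) (allFin m))) (perms m))

snocRow : {k : ℕ} {X : Set} → (Fin k → X) → X → Fin (suc k) → X
snocRow {zero}  f x zero    = x
snocRow {suc k} f x zero    = f zero
snocRow {suc k} f x (suc i) = snocRow (λ j → f (suc j)) x i

-- A k-subset A of [n] is encoded by its increasing enumeration a : Fin k → Fin n.
StrictlyIncreasing : {k n : ℕ} → (Fin k → Fin n) → Set
StrictlyIncreasing a = ∀ i j → i < j → a i < a j

subMat : {k n : ℕ} → (Fin k → Fin n → Bool) → (Fin k → Fin n) → Fin k → Fin k → ℤ
subMat Mk a r c = sgn (Mk r (a c))

-- M_{A ∪ {i}} : first k+1 rows (row k+1 = x), columns a 0, ..., a (k-1), i.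
-- (Column order is immaterial for the permanent.)
subMatExt : {k n : ℕ} → (Fin k → Fin n → Bool) → (Fin n → Bool) → (Fin k → Fin n) → Fin n
          → Fin (suc k) → Fin (suc k) → ℤ
subMatExt Mk x a i r c = sgn (snocRow Mk x r (snocRow a i c))

Good : {k n : ℕ} → (Fin k → Fin n → Bool) → (Fin k → Fin n) → Subset n → (Fin n → Bool) → Fin n → Set
Good Mk a I x i = (i ∈ I) × (∣ Per (subMat Mk a) ∣ ≤ ∣ Per (subMatExt Mk x a i) ∣)

good? : {k n : ℕ} → (Mk : Fin k → Fin n → Bool) → (a : Fin k → Fin n) → (I : Subset n)
      → (x : Fin n → Bool) → (i : Fin n) → Dec (Good Mk a I x i)
good? Mk a I x i = (i ∈? I) ×-dec (∣ Per (subMat Mk a) ∣ ≤ℕ? ∣ Per (subMatExt Mk x a i) ∣)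

goodCount : {k n : ℕ} → (Fin k → Fin n → Bool) → (Fin k → Fin n) → Subset n → (Fin n → Bool) → ℕ
goodCount {n = n} Mk a I x = length (filter (good? Mk a I x) (allFin n))

-- Number of rows x (out of 2^n equally likely) satisfying a decidable event.
countRows : {n : ℕ} {P : (Fin n → Bool) → Set} → ((x : Fin n → Bool) → Dec (P x)) → ℕ
countRows {n} P? = length (filter P? (allRows n))

-- Expanding the permanent along its last row, flipping the entry x i of the new row (i ∉ A) changes
-- Per(M_{A∪{i}}) by ±2·Per(M_A); hence for every row x the column i is good for x or for x with x i
-- flipped. Whether i is good depends only on x i and on the coordinates of x outside I, so given the
-- latter the events "i is good" (i ∈ I) are independent, each of probability at least 1/2. Therefore
-- E[∏_{i∈I} w_i] ≤ ((α + β)/2)^|I| for the weights w_i = α if i is good and β otherwise (α ≤ β).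
-- With α = 0, β = 1 this says P(no i is good) ≤ 2^-|I|. With α = 64, β = 125 the product is at least
-- 100^|I| when fewer than |I|/3 columns are good (as 64·125² = 100³), so by Markov's inequality
-- P(fewer than |I|/3 good) ≤ (189/200)^|I|.

module Submission where

open import Defs
open import Algebra.Bundles using (CommutativeSemiring)
open import Algebra.Structures using (IsMonoid; IsCommutativeSemiring)
open import Data.Bool using (Bool; true; false; not; _∧_; if_then_else_)
open import Data.Fin using (Fin; zero; suc; fromℕ; inject₁)
open import Data.Fin.Properties using (all?; _≟_; fromℕ≢inject₁; inject₁-injective; suc-injective)
open import Data.Fin.Subset using (Subset; _∈_; ∣_∣; inside; outside)
open import Data.Fin.Subset.Properties using (_∈?_)
open import Data.Integer as ℤ using (ℤ; _-_)
import Data.Integer.Properties as ℤ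
open import Data.List using (List; []; _∷_; _++_; map; foldr; filter; length; concatMap; tabulate; allFin)
open import Data.List.Properties using (map-cong; map-∘; map-tabulate)
open import Data.Nat using (ℕ; zero; suc)
open import Data.Product using (Σ; _×_; _,_)
open import Data.Sum using (_⊎_; inj₁; inj₂)
open import Data.Vec using ([]; _∷_; here; there)
import Data.Vec.Functional as V
open import Data.Vec.Functional.Properties using (updateAt-updates; updateAt-minimal)
open import Function using (id; _∘_; _⇔_; mk⇔)
open import Level using (0ℓ)
open import Relation.Binary.Core using (_Preserves_⟶_)
open import Relation.Binary.PropositionalEquality
open import Relation.Nullary using (Dec; yes; no; does; ¬_; ¬?; _×-dec_; _→-dec_; contradiction)
open import Relation.Nullary.Decidable using (dec-true; dec-false; does-⇔)
open import Relation.Unary using (Pred; Decidable)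

snocRow-inject₁ : ∀ {k} {X : Set} (f : Fin k → X) x r → snocRow f x (inject₁ r) ≡ f r
snocRow-inject₁ {suc k} f x zero    = refl
snocRow-inject₁ {suc k} f x (suc r) = snocRow-inject₁ (f ∘ suc) x r

snocRow-last : ∀ {k} {X : Set} (f : Fin k → X) x → snocRow f x (fromℕ k) ≡ x
snocRow-last {zero}  f x = refl
snocRow-last {suc k} f x = snocRow-last (f ∘ suc) x

snocRow-∷ : ∀ {k} {X : Set} (y : X) (f : Fin k → X) x → snocRow (y V.∷ f) x ≗ y V.∷ snocRow f x
snocRow-∷ {zero}  y f x zero          = refl
snocRow-∷ {zero}  y f x (suc zero)    = refl
snocRow-∷ {suc k} y f x zero          = refl
snocRow-∷ {suc k} y f x (suc i)       = refl

snocRow-cong : ∀ {k} {X : Set} {f g : Fin k → X} x → f ≗ g → snocRow f x ≗ snocRow g x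
snocRow-cong {zero}  x f≗g zero    = refl
snocRow-cong {suc k} x f≗g zero    = f≗g zero
snocRow-cong {suc k} x f≗g (suc i) = snocRow-cong x (f≗g ∘ suc) i

data LastView {k : ℕ} : Fin (suc k) → Set where
  last   : LastView (fromℕ k)
  inject : (r : Fin k) → LastView (inject₁ r)

lastView : ∀ {k} (i : Fin (suc k)) → LastView i
lastView {zero}  zero    = last
lastView {suc k} zero    = inject zero
lastView {suc k} (suc i) with lastView i
... | last     = last
... | inject r = inject (suc r)

∷-cong : ∀ {m} {X : Set} (b : X) {f g : Fin m → X} → f ≗ g → b V.∷ f ≗ b V.∷ g
∷-cong b f≗g zero    = refl
∷-cong b f≗g (suc i) = f≗g i

IsInjective : ∀ {k m} → (Fin k → Fin m) → Set
IsInjective f = ∀ i j → f i ≡ f j → i ≡ j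

-- On endomaps this is literally Defs.isPerm?, which the permutation sums below rely on.
injective? : ∀ {k m} (f : Fin k → Fin m) → Dec (IsInjective f)
injective? f = all? (λ i → all? (λ j → (f i ≟ f j) →-dec (i ≟ j)))

injective?-cong : ∀ {k m} {f g : Fin k → Fin m} → f ≗ g → does (injective? f) ≡ does (injective? g)
injective?-cong {f = f} {g} f≗g = does-⇔ (mk⇔ (λ inj i j e → inj i j (trans (f≗g i) (trans e (sym (f≗g j)))))
                                              (λ inj i j e → inj i j (trans (sym (f≗g i)) (trans e (f≗g j)))))
                                         (injective? f) (injective? g)

avoidsLast? : ∀ {k m} (f : Fin k → Fin (suc m)) → Dec (∀ r → f r ≢ fromℕ m)
avoidsLast? {m = m} f = all? (λ r → ¬? (f r ≟ fromℕ m))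

avoidsLast?-cong : ∀ {k m} {f g : Fin k → Fin (suc m)} → f ≗ g → does (avoidsLast? f) ≡ does (avoidsLast? g)
avoidsLast?-cong {f = f} {g} f≗g = does-⇔ (mk⇔ (λ av r e → av r (trans (f≗g r) e))
                                                (λ av r e → av r (trans (sym (f≗g r)) e)))
                                           (avoidsLast? f) (avoidsLast? g)

injective?-inject₁∘ : ∀ {k m} (g : Fin k → Fin m) → does (injective? (inject₁ ∘ g)) ≡ does (injective? g)
injective?-inject₁∘ g = does-⇔ (mk⇔ (λ inj i j e → inj i j (cong inject₁ e))
                                    (λ inj i j e → inj i j (inject₁-injective e)))
                               (injective? (inject₁ ∘ g)) (injective? g)

isPerm-snocRow-last : ∀ {k} (f : Fin k → Fin (suc k)) →
  IsPerm (snocRow f (fromℕ k)) ⇔ ((∀ r → f r ≢ fromℕ k) × IsInjective f)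
isPerm-snocRow-last {k} f = mk⇔ to from
  where
  σ = snocRow f (fromℕ k)
  σ-inject₁ = snocRow-inject₁ f (fromℕ k)
  σ-last = snocRow-last f (fromℕ k)

  to : IsPerm σ → (∀ r → f r ≢ fromℕ k) × IsInjective f
  to perm = (λ r e → fromℕ≢inject₁ (sym (perm _ _ (trans (σ-inject₁ r) (trans e (sym σ-last))))))
          , (λ i j e → inject₁-injective (perm _ _ (trans (σ-inject₁ i) (trans e (sym (σ-inject₁ j))))))

  from : (∀ r → f r ≢ fromℕ k) × IsInjective f → IsPerm σ
  from (avoids , inj) i j e with lastView i | lastView j
  ... | last     | last     = refl
  ... | last     | inject r = contradiction (trans (sym (σ-inject₁ r)) (trans (sym e) σ-last)) (avoids r)
  ... | inject r | last     = contradiction (trans (sym (σ-inject₁ r)) (trans e σ-last)) (avoids r)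
  ... | inject r | inject s = cong inject₁ (inj r s (trans (sym (σ-inject₁ r)) (trans e (σ-inject₁ s))))

module FoldAllFin {A : Set} {_∙_ : A → A → A} {ε : A} (isMonoid : IsMonoid _≡_ _∙_ ε) where
  open IsMonoid isMonoid using (assoc; identityˡ; identityʳ)

  private
    foldr-tabulate-last : ∀ n (f : Fin (suc n) → A) →
      foldr _∙_ ε (tabulate f) ≡ foldr _∙_ ε (tabulate (f ∘ inject₁)) ∙ f (fromℕ n)
    foldr-tabulate-last zero    f = trans (identityʳ (f zero)) (sym (identityˡ (f zero)))
    foldr-tabulate-last (suc n) f = trans (cong (f zero ∙_) (foldr-tabulate-last n (f ∘ suc)))
                                          (sym (assoc (f zero) _ _))

  foldr-map-allFin-last : ∀ n (f : Fin (suc n) → A) →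
    foldr _∙_ ε (map f (allFin (suc n))) ≡ foldr _∙_ ε (map (f ∘ inject₁) (allFin n)) ∙ f (fromℕ n)
  foldr-map-allFin-last n f = begin
      foldr _∙_ ε (map f (allFin (suc n)))
    ≡⟨ cong (foldr _∙_ ε) (map-tabulate id f) ⟩
      foldr _∙_ ε (tabulate f)
    ≡⟨ foldr-tabulate-last n f ⟩
      foldr _∙_ ε (tabulate (f ∘ inject₁)) ∙ f (fromℕ n)
    ≡⟨ cong (λ xs → foldr _∙_ ε xs ∙ f (fromℕ n)) (map-tabulate id (f ∘ inject₁)) ⟨
      foldr _∙_ ε (map (f ∘ inject₁) (allFin n)) ∙ f (fromℕ n) ∎
    where open ≡-Reasoning

module ListSum {A : Set} {add mul : A → A → A} {zeroᴬ oneᴬ : A}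
               (isCS : IsCommutativeSemiring _≡_ add mul zeroᴬ oneᴬ) where

  private
    R : CommutativeSemiring 0ℓ 0ℓ
    R = record { isCommutativeSemiring = isCS }

  open CommutativeSemiring R using (_+_; _*_; 0#)

  open IsCommutativeSemiring isCS
    using (+-identityˡ; +-identityʳ; +-assoc; distribˡ; zeroʳ; +-isMonoid)
  open import Algebra.Properties.CommutativeSemigroup (CommutativeSemiring.+-commutativeSemigroup R)
    using (interchange)
  open ≡-Reasoning

  private variable X Y : Set

  ∑ : List X → (X → A) → A
  ∑ xs f = foldr _+_ 0# (map f xs)

  syntax ∑ xs (λ x → e) = ∑[ x ∈ xs ] e

  when : Bool → A → A
  when b v = if b then v else 0#

  when-∧ : ∀ a b v → when (a ∧ b) v ≡ when a (when b v)
  when-∧ true  b v = refl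
  when-∧ false b v = refl

  *-when : ∀ c b v → c * when b v ≡ when b (c * v)
  *-when c true  v = refl
  *-when c false v = zeroʳ c

  ∑-cong : ∀ (xs : List X) {f g : X → A} → f ≗ g → ∑ xs f ≡ ∑ xs g
  ∑-cong xs f≗g = cong (foldr _+_ 0#) (map-cong f≗g xs)

  ∑-++ : ∀ (xs ys : List X) f → ∑ (xs ++ ys) f ≡ ∑ xs f + ∑ ys f
  ∑-++ []       ys f = sym (+-identityˡ _)
  ∑-++ (x ∷ xs) ys f = trans (cong (f x +_) (∑-++ xs ys f)) (sym (+-assoc _ _ _))

  ∑-map : ∀ (g : Y → X) ys f → ∑ (map g ys) f ≡ ∑ ys (f ∘ g)
  ∑-map g ys f = cong (foldr _+_ 0#) (sym (map-∘ ys))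

  ∑-concatMap : ∀ (φ : Y → List X) ys f → ∑ (concatMap φ ys) f ≡ ∑[ y ∈ ys ] ∑ (φ y) f
  ∑-concatMap φ []       f = refl
  ∑-concatMap φ (y ∷ ys) f = trans (∑-++ (φ y) _ f) (cong (∑ (φ y) f +_) (∑-concatMap φ ys f))

  ∑-distrib-+ : ∀ (xs : List X) f g → ∑[ x ∈ xs ] (f x + g x) ≡ ∑ xs f + ∑ xs g
  ∑-distrib-+ []       f g = sym (+-identityˡ 0#)
  ∑-distrib-+ (x ∷ xs) f g = trans (cong (f x + g x +_) (∑-distrib-+ xs f g)) (interchange _ _ _ _)

  *-distribˡ-∑ : ∀ c (xs : List X) f → c * ∑ xs f ≡ ∑[ x ∈ xs ] (c * f x)
  *-distribˡ-∑ c []       f = zeroʳ c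
  *-distribˡ-∑ c (x ∷ xs) f = trans (distribˡ c _ _) (cong (c * f x +_) (*-distribˡ-∑ c xs f))

  ∑-zero : ∀ (xs : List X) → ∑[ x ∈ xs ] 0# ≡ 0#
  ∑-zero []       = refl
  ∑-zero (x ∷ xs) = trans (cong (0# +_) (∑-zero xs)) (+-identityˡ 0#)

  ∑-when : ∀ b (xs : List X) f → ∑[ x ∈ xs ] when b (f x) ≡ when b (∑ xs f)
  ∑-when true  xs f = refl
  ∑-when false xs f = ∑-zero xs

  ∑-filter : ∀ {p} {P : Pred X p} (P? : Decidable P) xs f →
    ∑ (filter P? xs) f ≡ ∑[ x ∈ xs ] when (does (P? x)) (f x)
  ∑-filter P? []       f = refl
  ∑-filter P? (x ∷ xs) f with does (P? x)
  ... | true  = cong (f x +_) (∑-filter P? xs f)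
  ... | false = sym (trans (+-identityˡ _) (sym (∑-filter P? xs f)))

  ∑-comm : ∀ (xs : List X) (ys : List Y) (f : X → Y → A) →
    ∑[ x ∈ xs ] ∑[ y ∈ ys ] f x y ≡ ∑[ y ∈ ys ] ∑[ x ∈ xs ] f x y
  ∑-comm []       ys f = sym (∑-zero ys)
  ∑-comm (x ∷ xs) ys f = trans (cong (∑ ys (f x) +_) (∑-comm xs ys f))
                               (sym (∑-distrib-+ ys (f x) _))

  ∑-allFin-suc : ∀ n (f : Fin (suc n) → A) → ∑ (allFin (suc n)) f ≡ f zero + ∑[ i ∈ allFin n ] f (suc i)
  ∑-allFin-suc n f = cong (λ xs → f zero + foldr _+_ 0# xs)
                          (trans (map-tabulate suc f) (sym (map-tabulate id (f ∘ suc))))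

  open FoldAllFin +-isMonoid using () renaming (foldr-map-allFin-last to ∑-allFin-last)

  private
    off-last : ∀ {n} (r : Fin n) → does (inject₁ r ≟ fromℕ n) ≡ false
    off-last {n} r = dec-false (inject₁ r ≟ fromℕ n) (fromℕ≢inject₁ ∘ sym)

  ∑-allFin-at-last : ∀ n (v : Fin (suc n) → A) →
    ∑[ c ∈ allFin (suc n) ] when (does (c ≟ fromℕ n)) (v c) ≡ v (fromℕ n)
  ∑-allFin-at-last n v = begin
      ∑[ c ∈ allFin (suc n) ] when (does (c ≟ fromℕ n)) (v c)
    ≡⟨ ∑-allFin-last n _ ⟩
      ∑[ r ∈ allFin n ] when (does (inject₁ r ≟ fromℕ n)) (v (inject₁ r))
        + when (does (fromℕ n ≟ fromℕ n)) (v (fromℕ n))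
    ≡⟨ cong₂ _+_ (trans (∑-cong (allFin n) λ r → cong (λ b → when b (v (inject₁ r))) (off-last r)) (∑-zero (allFin n)))
                 (cong (λ b → when b (v (fromℕ n))) (dec-true (fromℕ n ≟ fromℕ n) refl)) ⟩
      0# + v (fromℕ n)
    ≡⟨ +-identityˡ _ ⟩
      v (fromℕ n) ∎

  ∑-allFin-off-last : ∀ n (v : Fin (suc n) → A) →
    ∑[ c ∈ allFin (suc n) ] when (not (does (c ≟ fromℕ n))) (v c) ≡ ∑[ r ∈ allFin n ] v (inject₁ r)
  ∑-allFin-off-last n v = begin
      ∑[ c ∈ allFin (suc n) ] when (not (does (c ≟ fromℕ n))) (v c)
    ≡⟨ ∑-allFin-last n _ ⟩
      ∑[ r ∈ allFin n ] when (not (does (inject₁ r ≟ fromℕ n))) (v (inject₁ r))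
        + when (not (does (fromℕ n ≟ fromℕ n))) (v (fromℕ n))
    ≡⟨ cong₂ _+_ (∑-cong (allFin n) λ r → cong (λ b → when (not b) (v (inject₁ r))) (off-last r))
                 (cong (λ b → when (not b) (v (fromℕ n))) (dec-true (fromℕ n ≟ fromℕ n) refl)) ⟩
      ∑[ r ∈ allFin n ] v (inject₁ r) + 0#
    ≡⟨ +-identityʳ _ ⟩
      ∑[ r ∈ allFin n ] v (inject₁ r) ∎

  ∑-allFuns-∷ : ∀ {m} (xs : List X) (G : (Fin (suc m) → X) → A) → G Preserves _≗_ ⟶ _≡_ →
    ∑ (allFuns (suc m) xs) G ≡ ∑[ b ∈ xs ] ∑[ f ∈ allFuns m xs ] G (b V.∷ f)
  ∑-allFuns-∷ {m = m} xs G G-ext = trans (∑-concatMap _ xs G) (∑-cong xs λ b →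
    trans (∑-map _ (allFuns m xs) G) (∑-cong (allFuns m xs) λ f →
      G-ext {y = b V.∷ f} λ { zero → refl ; (suc i) → refl }))

  ∑-allFuns-snoc : ∀ m (xs : List X) (G : (Fin (suc m) → X) → A) → G Preserves _≗_ ⟶ _≡_ →
    ∑ (allFuns (suc m) xs) G ≡ ∑[ c ∈ xs ] ∑[ f ∈ allFuns m xs ] G (snocRow f c)
  ∑-allFuns-snoc zero    xs G G-ext = trans (∑-allFuns-∷ xs G G-ext)
                                            (∑-cong xs λ c → cong (_+ 0#) (G-ext λ { zero → refl }))
  ∑-allFuns-snoc (suc m) xs G G-ext = begin
      ∑ (allFuns (suc (suc m)) xs) G
    ≡⟨ ∑-allFuns-∷ xs G G-ext ⟩
      ∑[ b ∈ xs ] ∑[ f ∈ allFuns (suc m) xs ] G (b V.∷ f)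
    ≡⟨ ∑-cong xs (λ b → ∑-allFuns-snoc m xs (G ∘ (b V.∷_)) (G-ext ∘ ∷-cong b)) ⟩
      ∑[ b ∈ xs ] ∑[ c ∈ xs ] ∑[ f ∈ allFuns m xs ] G (b V.∷ snocRow f c)
    ≡⟨ ∑-comm xs xs _ ⟩
      ∑[ c ∈ xs ] ∑[ b ∈ xs ] ∑[ f ∈ allFuns m xs ] G (b V.∷ snocRow f c)
    ≡⟨ ∑-cong xs (λ c → ∑-cong xs λ b → ∑-cong (allFuns m xs) λ f → G-ext (snocRow-∷ b f c)) ⟨
      ∑[ c ∈ xs ] ∑[ b ∈ xs ] ∑[ f ∈ allFuns m xs ] G (snocRow (b V.∷ f) c)
    ≡⟨ ∑-cong xs (λ c → ∑-allFuns-∷ xs (λ f → G (snocRow f c)) (G-ext ∘ snocRow-cong c)) ⟨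
      ∑[ c ∈ xs ] ∑[ f ∈ allFuns (suc m) xs ] G (snocRow f c) ∎

  when-comm : ∀ a b v → when a (when b v) ≡ when b (when a v)
  when-comm true  b     v = refl
  when-comm false true  v = refl
  when-comm false false v = refl

  ∑-allFuns-avoiding-last : ∀ k {m} (H : (Fin k → Fin (suc m)) → A) → H Preserves _≗_ ⟶ _≡_ →
    ∑[ f ∈ allFuns k (allFin (suc m)) ] when (does (avoidsLast? f)) (H f)
      ≡ ∑[ g ∈ allFuns k (allFin m) ] H (inject₁ ∘ g)
  ∑-allFuns-avoiding-last zero    H H-ext = cong (_+ 0#) (H-ext λ ())
  ∑-allFuns-avoiding-last (suc k) {m} H H-ext = begin
      ∑[ f ∈ allFuns (suc k) (allFin (suc m)) ] when (does (avoidsLast? f)) (H f)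
    ≡⟨ ∑-allFuns-∷ (allFin (suc m)) _ (λ f≗g → cong₂ when (avoidsLast?-cong f≗g) (H-ext f≗g)) ⟩
      ∑[ c ∈ allFin (suc m) ] ∑[ f ∈ Fs ] when (not (does (c ≟ l)) ∧ does (avoidsLast? f)) (H (c V.∷ f))
    ≡⟨ ∑-cong (allFin (suc m)) (λ c → trans (∑-cong Fs λ f → when-∧ (not (does (c ≟ l))) _ (H (c V.∷ f)))
                                          (∑-when (not (does (c ≟ l))) Fs _)) ⟩
      ∑[ c ∈ allFin (suc m) ] when (not (does (c ≟ l))) (∑[ f ∈ Fs ] when (does (avoidsLast? f)) (H (c V.∷ f)))
    ≡⟨ ∑-cong (allFin (suc m)) (λ c →
         cong (when (not (does (c ≟ l)))) (∑-allFuns-avoiding-last k (H ∘ (c V.∷_)) (H-ext ∘ ∷-cong c))) ⟩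
      ∑[ c ∈ allFin (suc m) ] when (not (does (c ≟ l))) (∑[ g ∈ Gs ] H (c V.∷ (inject₁ ∘ g)))
    ≡⟨ ∑-allFin-off-last m _ ⟩
      ∑[ c ∈ allFin m ] ∑[ g ∈ Gs ] H (inject₁ c V.∷ (inject₁ ∘ g))
    ≡⟨ ∑-cong (allFin m) (λ c → ∑-cong Gs λ g → H-ext λ { zero → refl ; (suc i) → refl }) ⟩
      ∑[ c ∈ allFin m ] ∑[ g ∈ Gs ] H (inject₁ ∘ (c V.∷ g))
    ≡⟨ ∑-allFuns-∷ (allFin m) (H ∘ (inject₁ ∘_)) (λ f≗g → H-ext (cong inject₁ ∘ f≗g)) ⟨
      ∑[ g ∈ allFuns (suc k) (allFin m) ] H (inject₁ ∘ g) ∎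
    where
    l = fromℕ m
    Fs = allFuns k (allFin (suc m))
    Gs = allFuns k (allFin m)

  ∑-perms-fixing-last : ∀ k (F : (Fin k → Fin (suc k)) → A) → F Preserves _≗_ ⟶ _≡_ →
    ∑[ σ ∈ perms (suc k) ] when (does (σ (fromℕ k) ≟ fromℕ k)) (F (σ ∘ inject₁))
      ≡ ∑[ τ ∈ perms k ] F (inject₁ ∘ τ)
  ∑-perms-fixing-last k F F-ext = begin
      ∑ (perms (suc k)) G
    ≡⟨ ∑-filter isPerm? (allFuns (suc k) (allFin (suc k))) G ⟩
      ∑[ σ ∈ allFuns (suc k) (allFin (suc k)) ] when (does (isPerm? σ)) (G σ)
    ≡⟨ ∑-allFuns-snoc k (allFin (suc k)) _ (λ σ≗τ → cong₂ when (injective?-cong σ≗τ) (G-ext σ≗τ)) ⟩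
      ∑[ c ∈ allFin (suc k) ] ∑[ f ∈ Fs ] when (does (isPerm? (snocRow f c))) (G (snocRow f c))
    ≡⟨ ∑-cong (allFin (suc k)) (λ c → trans (∑-cong Fs (fix-last c)) (∑-when (does (c ≟ l)) Fs _)) ⟩
      ∑[ c ∈ allFin (suc k) ] when (does (c ≟ l)) (∑[ f ∈ Fs ] when (does (isPerm? (snocRow f c))) (F f))
    ≡⟨ ∑-allFin-at-last k _ ⟩
      ∑[ f ∈ Fs ] when (does (isPerm? (snocRow f l))) (F f)
    ≡⟨ ∑-cong Fs (λ f → trans (cong (λ b → when b (F f)) (isPerm?-snocRow-last f))
                              (when-∧ (does (avoidsLast? f)) (does (injective? f)) (F f))) ⟩
      ∑[ f ∈ Fs ] when (does (avoidsLast? f)) (when (does (injective? f)) (F f))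
    ≡⟨ ∑-allFuns-avoiding-last k _ (λ f≗g → cong₂ when (injective?-cong f≗g) (F-ext f≗g)) ⟩
      ∑[ g ∈ allFuns k (allFin k) ] when (does (injective? (inject₁ ∘ g))) (F (inject₁ ∘ g))
    ≡⟨ ∑-cong (allFuns k (allFin k)) (λ g → cong (λ b → when b (F (inject₁ ∘ g))) (injective?-inject₁∘ g)) ⟩
      ∑[ g ∈ allFuns k (allFin k) ] when (does (isPerm? g)) (F (inject₁ ∘ g))
    ≡⟨ ∑-filter isPerm? (allFuns k (allFin k)) (F ∘ (inject₁ ∘_)) ⟨
      ∑[ τ ∈ perms k ] F (inject₁ ∘ τ) ∎
    where
    l = fromℕ k
    Fs = allFuns k (allFin (suc k))
    isPerm?-snocRow-last : ∀ f → does (isPerm? (snocRow f l)) ≡ does (avoidsLast? f) ∧ does (injective? f)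
    isPerm?-snocRow-last f = does-⇔ (isPerm-snocRow-last f) (isPerm? (snocRow f l)) (avoidsLast? f ×-dec injective? f)
    G : (Fin (suc k) → Fin (suc k)) → A
    G σ = when (does (σ l ≟ l)) (F (σ ∘ inject₁))
    G-ext : G Preserves _≗_ ⟶ _≡_
    G-ext {σ} {τ} σ≗τ = cong₂ when (cong (λ c → does (c ≟ l)) (σ≗τ l)) (F-ext (σ≗τ ∘ inject₁))
    fix-last : ∀ c f → when (does (isPerm? (snocRow f c))) (G (snocRow f c))
                     ≡ when (does (c ≟ l)) (when (does (isPerm? (snocRow f c))) (F f))
    fix-last c f = begin
        when (does (isPerm? (snocRow f c))) (G (snocRow f c))
      ≡⟨ cong (when (does (isPerm? (snocRow f c))))
              (cong₂ when (cong (λ c′ → does (c′ ≟ l)) (snocRow-last f c)) (F-ext (snocRow-inject₁ f c))) ⟩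
        when (does (isPerm? (snocRow f c))) (when (does (c ≟ l)) (F f))
      ≡⟨ when-comm (does (isPerm? (snocRow f c))) (does (c ≟ l)) (F f) ⟩
        when (does (c ≟ l)) (when (does (isPerm? (snocRow f c))) (F f)) ∎

module Permanent where
  open import Data.Integer using (_+_; _-_; _*_)
  import Data.Integer.Tactic.RingSolver as ℤ-Solver
  open ListSum ℤ.+-*-isCommutativeSemiring
    using (∑; when; ∑-cong; ∑-distrib-+; *-distribˡ-∑; *-when; ∑-perms-fixing-last)
  open FoldAllFin ℤ.*-1-isMonoid using () renaming (foldr-map-allFin-last to prod-allFin-last)

  minor : ∀ {k} → (Fin (suc k) → Fin (suc k) → ℤ) → Fin k → Fin k → ℤ
  minor M r c = M (inject₁ r) (inject₁ c)

  Per-cong : ∀ {m} {M M' : Fin m → Fin m → ℤ} → (∀ r c → M r c ≡ M' r c) → Per M ≡ Per M'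
  Per-cong {m} M≡M' =
    cong sumℤ (map-cong (λ σ → cong prodℤ (map-cong (λ i → M≡M' i (σ i)) (allFin m))) (perms m))

  Per-last-entry : ∀ k (M M' : Fin (suc k) → Fin (suc k) → ℤ) →
    (∀ r c → M (inject₁ r) c ≡ M' (inject₁ r) c) →
    (∀ c → M (fromℕ k) (inject₁ c) ≡ M' (fromℕ k) (inject₁ c)) →
    Per M - Per M' ≡ (M (fromℕ k) (fromℕ k) - M' (fromℕ k) (fromℕ k)) * Per (minor M)
  Per-last-entry k M M' upper-rows last-row = trans (cong (_- Per M') expansion) ([b+d]-b≡d (Per M') _)
    where
    open ≡-Reasoning
    l = fromℕ k
    D = M l l - M' l l

    [b+d]-b≡d : ∀ b d → b + d - b ≡ d
    [b+d]-b≡d = ℤ-Solver.solve-∀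

    a≡b+[a-b] : ∀ a b → a ≡ b + (a - b)
    a≡b+[a-b] = ℤ-Solver.solve-∀

    diagonal : (Fin (suc k) → Fin (suc k) → ℤ) → (Fin (suc k) → Fin (suc k)) → ℤ
    diagonal A σ = prodℤ (map (λ i → A i (σ i)) (allFin (suc k)))

    F : (Fin k → Fin (suc k)) → ℤ
    F f = prodℤ (map (λ r → M (inject₁ r) (f r)) (allFin k))

    F-ext : ∀ {f g} → f ≗ g → F f ≡ F g
    F-ext f≗g = cong prodℤ (map-cong (λ r → cong (M (inject₁ r)) (f≗g r)) (allFin k))

    last-row-entry : ∀ c → M l c ≡ M' l c + when (does (c ≟ l)) D
    last-row-entry c with lastView c
    ... | last     = trans (a≡b+[a-b] (M l l) (M' l l)) (cong (λ b → M' l l + when b D) (sym (dec-true (l ≟ l) refl)))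
    ... | inject r = trans (trans (last-row r) (sym (ℤ.+-identityʳ _)))
                           (cong (λ b → M' l (inject₁ r) + when b D)
                                 (sym (dec-false (inject₁ r ≟ l) (fromℕ≢inject₁ ∘ sym))))

    expand : ∀ σ → diagonal M σ ≡ diagonal M' σ + D * when (does (σ l ≟ l)) (F (σ ∘ inject₁))
    expand σ = begin
        diagonal M σ
      ≡⟨ prod-allFin-last k (λ i → M i (σ i)) ⟩
        F (σ ∘ inject₁) * M l (σ l)
      ≡⟨ cong (F (σ ∘ inject₁) *_) (last-row-entry (σ l)) ⟩
        F (σ ∘ inject₁) * (M' l (σ l) + when b D)
      ≡⟨ ℤ.*-distribˡ-+ (F (σ ∘ inject₁)) _ _ ⟩
        F (σ ∘ inject₁) * M' l (σ l) + F (σ ∘ inject₁) * when b D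
      ≡⟨ cong₂ _+_ (cong (λ p → prodℤ p * M' l (σ l)) (map-cong (λ r → upper-rows r (σ (inject₁ r))) (allFin k)))
                   (trans (*-when (F (σ ∘ inject₁)) b D) (trans (cong (when b) (ℤ.*-comm (F (σ ∘ inject₁)) D))
                                                             (sym (*-when D b (F (σ ∘ inject₁)))))) ⟩
        F′ * M' l (σ l) + D * when b (F (σ ∘ inject₁))
      ≡⟨ cong (_+ D * when b (F (σ ∘ inject₁))) (prod-allFin-last k (λ i → M' i (σ i))) ⟨
        diagonal M' σ + D * when b (F (σ ∘ inject₁)) ∎
      where
      b = does (σ l ≟ l)
      F′ = prodℤ (map (λ r → M' (inject₁ r) (σ (inject₁ r))) (allFin k))

    expansion : Per M ≡ Per M' + D * Per (minor M)
    expansion = begin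
        ∑[ σ ∈ perms (suc k) ] diagonal M σ
      ≡⟨ ∑-cong (perms (suc k)) expand ⟩
        ∑[ σ ∈ perms (suc k) ] (diagonal M' σ + D * when (does (σ l ≟ l)) (F (σ ∘ inject₁)))
      ≡⟨ ∑-distrib-+ (perms (suc k)) (diagonal M') _ ⟩
        Per M' + ∑[ σ ∈ perms (suc k) ] (D * when (does (σ l ≟ l)) (F (σ ∘ inject₁)))
      ≡⟨ cong (Per M' +_) (*-distribˡ-∑ D (perms (suc k)) _) ⟨
        Per M' + D * ∑[ σ ∈ perms (suc k) ] when (does (σ l ≟ l)) (F (σ ∘ inject₁))
      ≡⟨ cong (λ s → Per M' + D * s) (∑-perms-fixing-last k F F-ext) ⟩
        Per M' + D * Per (minor M) ∎

open Permanent using (Per-cong; Per-last-entry)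

open import Data.Nat using (_+_; _*_; _∸_; _^_; _≤_; _<_; _≤?_; z≤n)
open import Data.Nat.Properties
  using (≤-refl; ≤-reflexive; ≤-trans; +-comm; +-suc; +-identityʳ; *-identityʳ; *-identityˡ; *-assoc; *-zeroʳ;
         *-distribˡ-+; *-distribʳ-+; *-distribʳ-∸; +-mono-≤; +-monoʳ-≤; +-mono-<; *-monoʳ-≤; *-monoˡ-≤;
         ^-monoˡ-≤; ^-zeroˡ; ^-distribˡ-+-*; ∸-monoʳ-≤; m+n∸n≡m; m≤n⇒∃[o]m+o≡n; +-cancelˡ-<; <⇒≤; ≰⇒>; ≤⇒≯;
         m≤m+n; module ≤-Reasoning; +-*-isCommutativeSemiring)
open import Data.Nat.Tactic.RingSolver using (solve-∀)

open ListSum +-*-isCommutativeSemiring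

flipAt : ∀ {n} → Fin n → (Fin n → Bool) → Fin n → Bool
flipAt i x = V.updateAt x i not

flipAt-zero : ∀ {n} b (x : Fin n → Bool) → flipAt zero (b V.∷ x) ≗ not b V.∷ x
flipAt-zero b x zero    = refl
flipAt-zero b x (suc q) = refl

flipAt-suc : ∀ {n} (j : Fin n) b x → flipAt (suc j) (b V.∷ x) ≗ b V.∷ flipAt j x
flipAt-suc j b x zero    = refl
flipAt-suc j b x (suc q) = refl

∑-mono-≤ : ∀ {X : Set} (xs : List X) {f g : X → ℕ} → (∀ x → f x ≤ g x) → ∑ xs f ≤ ∑ xs g
∑-mono-≤ []       f≤g = ≤-refl
∑-mono-≤ (x ∷ xs) f≤g = +-mono-≤ (f≤g x) (∑-mono-≤ xs f≤g)

∑-allRows-suc : ∀ n (G : (Fin (suc n) → Bool) → ℕ) → G Preserves _≗_ ⟶ _≡_ →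
  ∑ (allRows (suc n)) G ≡ ∑[ x ∈ allRows n ] G (true V.∷ x) + ∑[ x ∈ allRows n ] G (false V.∷ x)
∑-allRows-suc n G G-ext = trans (∑-allFuns-∷ (true ∷ false ∷ []) G G-ext)
                                (cong (∑[ x ∈ allRows n ] G (true V.∷ x) +_) (+-identityʳ _))

∑-allRows-1 : ∀ n → ∑[ x ∈ allRows n ] 1 ≡ 2 ^ n
∑-allRows-1 zero    = refl
∑-allRows-1 (suc n) = trans (∑-allRows-suc n (λ _ → 1) (λ _ → refl))
                            (cong₂ _+_ (∑-allRows-1 n) (trans (∑-allRows-1 n) (sym (+-identityʳ (2 ^ n)))))

prodOver : ∀ {n} → Subset n → (Fin n → ℕ) → ℕ
prodOver []            g = 1
prodOver (inside ∷ I)  g = g zero * prodOver I (g ∘ suc)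
prodOver (outside ∷ I) g = prodOver I (g ∘ suc)

syntax prodOver I (λ i → e) = ∏[ i ∈ I ] e

prodOver-cong : ∀ {n} (I : Subset n) {g h : Fin n → ℕ} → g ≗ h → prodOver I g ≡ prodOver I h
prodOver-cong []            g≗h = refl
prodOver-cong (inside ∷ I)  g≗h = cong₂ _*_ (g≗h zero) (prodOver-cong I (g≗h ∘ suc))
prodOver-cong (outside ∷ I) g≗h = prodOver-cong I (g≗h ∘ suc)

record Pairing {n} (I : Subset n) (f : Fin n → (Fin n → Bool) → ℕ) (B : ℕ) : Set where
  field
    extensional    : ∀ i → f i Preserves _≗_ ⟶ _≡_
    flip-invariant : ∀ i j → j ∈ I → j ≢ i → ∀ x → f i (flipAt j x) ≡ f i x
    flip-pair-≤    : ∀ i → i ∈ I → ∀ x → f i x + f i (flipAt i x) ≤ B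

pairing-tail : ∀ {n b} {I : Subset n} {f B} → Pairing (b ∷ I) f B →
  ∀ c → Pairing I (λ i x → f (suc i) (c V.∷ x)) B
pairing-tail {I = I} {f} {B} p c = record
  { extensional    = λ i x≗y → extensional (suc i) (∷-cong c x≗y)
  ; flip-invariant = λ i j j∈I j≢i x →
      trans (extensional (suc i) (sym ∘ flipAt-suc j c x))
            (flip-invariant (suc i) (suc j) (there j∈I) (j≢i ∘ suc-injective) (c V.∷ x))
  ; flip-pair-≤    = λ i i∈I x →
      subst (λ y → f (suc i) (c V.∷ x) + y ≤ B) (extensional (suc i) (flipAt-suc i c x))
            (flip-pair-≤ (suc i) (there i∈I) (c V.∷ x))
  }
  where open Pairing p

∏-extensional : ∀ {n} (I : Subset n) {f B} → Pairing I f B → (λ x → ∏[ i ∈ I ] f i x) Preserves _≗_ ⟶ _≡_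
∏-extensional I p x≗y = prodOver-cong I (λ i → Pairing.extensional p i x≗y)

∑-first-coordinate-≤ : ∀ {n} {I : Subset n} {f B} (p : Pairing (inside ∷ I) f B) →
  ∑[ x ∈ allRows (suc n) ] ∏[ i ∈ inside ∷ I ] f i x
    ≤ B * ∑[ x ∈ allRows n ] ∏[ i ∈ I ] f (suc i) (true V.∷ x)
∑-first-coordinate-≤ {n} {I} {f} {B} p = begin
    ∑[ x ∈ allRows (suc n) ] (f zero x * W x)
  ≡⟨ ∑-allRows-suc n _ (∏-extensional (inside ∷ I) p) ⟩
    ∑[ x ∈ allRows n ] (f zero (true V.∷ x) * W (true V.∷ x))
      + ∑[ x ∈ allRows n ] (f zero (false V.∷ x) * W (false V.∷ x))
  ≡⟨ cong (∑ (allRows n) (λ x → f zero (true V.∷ x) * W (true V.∷ x)) +_)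
          (∑-cong (allRows n) λ x → cong (f zero (false V.∷ x) *_) (W-false≡W-true x)) ⟩
    ∑[ x ∈ allRows n ] (f zero (true V.∷ x) * W (true V.∷ x))
      + ∑[ x ∈ allRows n ] (f zero (false V.∷ x) * W (true V.∷ x))
  ≡⟨ ∑-distrib-+ (allRows n) _ _ ⟨
    ∑[ x ∈ allRows n ] (f zero (true V.∷ x) * W (true V.∷ x) + f zero (false V.∷ x) * W (true V.∷ x))
  ≤⟨ ∑-mono-≤ (allRows n) (λ x → subst (_≤ B * W (true V.∷ x))
                                        (*-distribʳ-+ (W (true V.∷ x)) (f zero (true V.∷ x)) _)
                                        (*-monoˡ-≤ (W (true V.∷ x)) (pair x))) ⟩
    ∑[ x ∈ allRows n ] (B * W (true V.∷ x))
  ≡⟨ *-distribˡ-∑ B (allRows n) _ ⟨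
    B * ∑[ x ∈ allRows n ] W (true V.∷ x) ∎
  where
  open ≤-Reasoning
  open Pairing p
  W : (Fin (suc n) → Bool) → ℕ
  W x = ∏[ i ∈ I ] f (suc i) x
  W-false≡W-true : ∀ x → W (false V.∷ x) ≡ W (true V.∷ x)
  W-false≡W-true x = prodOver-cong I λ i →
    trans (extensional (suc i) (sym ∘ flipAt-zero true x)) (flip-invariant (suc i) zero here (λ ()) (true V.∷ x))
  pair : ∀ x → f zero (true V.∷ x) + f zero (false V.∷ x) ≤ B
  pair x = subst (λ y → f zero (true V.∷ x) + y ≤ B) (extensional zero (flipAt-zero true x))
                 (flip-pair-≤ zero here (true V.∷ x))

pairing-bound : ∀ {n} (I : Subset n) {f B} → Pairing I f B →
  2 ^ ∣ I ∣ * ∑[ x ∈ allRows n ] ∏[ i ∈ I ] f i x ≤ 2 ^ n * B ^ ∣ I ∣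
pairing-bound []            p = ≤-refl
pairing-bound {suc n} (outside ∷ I) {f} {B} p = begin
    2 ^ ∣ I ∣ * ∑[ x ∈ allRows (suc n) ] W x
  ≡⟨ cong (2 ^ ∣ I ∣ *_) (∑-allRows-suc n W (∏-extensional (outside ∷ I) p)) ⟩
    2 ^ ∣ I ∣ * (∑[ x ∈ allRows n ] W (true V.∷ x) + ∑[ x ∈ allRows n ] W (false V.∷ x))
  ≡⟨ *-distribˡ-+ (2 ^ ∣ I ∣) _ _ ⟩
    2 ^ ∣ I ∣ * ∑[ x ∈ allRows n ] W (true V.∷ x) + 2 ^ ∣ I ∣ * ∑[ x ∈ allRows n ] W (false V.∷ x)
  ≤⟨ +-mono-≤ (pairing-bound I (pairing-tail p true)) (pairing-bound I (pairing-tail p false)) ⟩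
    2 ^ n * B ^ ∣ I ∣ + 2 ^ n * B ^ ∣ I ∣
  ≡⟨ double (2 ^ n) (B ^ ∣ I ∣) ⟩
    2 ^ suc n * B ^ ∣ I ∣ ∎
  where
  open ≤-Reasoning
  W : (Fin (suc n) → Bool) → ℕ
  W x = ∏[ i ∈ I ] f (suc i) x
  double : ∀ a b → a * b + a * b ≡ 2 * a * b
  double = solve-∀
pairing-bound {suc n} (inside ∷ I) {f} {B} p = begin
    2 ^ suc ∣ I ∣ * ∑[ x ∈ allRows (suc n) ] ∏[ i ∈ inside ∷ I ] f i x
  ≤⟨ *-monoʳ-≤ (2 ^ suc ∣ I ∣) (∑-first-coordinate-≤ p) ⟩
    2 ^ suc ∣ I ∣ * (B * S)
  ≡⟨ regroup (2 ^ ∣ I ∣) B S ⟩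
    2 * B * (2 ^ ∣ I ∣ * S)
  ≤⟨ *-monoʳ-≤ (2 * B) (pairing-bound I (pairing-tail p true)) ⟩
    2 * B * (2 ^ n * B ^ ∣ I ∣)
  ≡⟨ regroup′ (2 ^ n) B (B ^ ∣ I ∣) ⟩
    2 ^ suc n * B ^ suc ∣ I ∣ ∎
  where
  open ≤-Reasoning
  S = ∑[ x ∈ allRows n ] ∏[ i ∈ I ] f (suc i) (true V.∷ x)
  regroup : ∀ a b c → 2 * a * (b * c) ≡ 2 * b * (a * c)
  regroup = solve-∀
  regroup′ : ∀ a b c → 2 * b * (a * c) ≡ 2 * a * (b * c)
  regroup′ = solve-∀

∣sgn-sgn∘not∣ : ∀ b → ℤ.∣ sgn b - sgn (not b) ∣ ≡ 2
∣sgn-sgn∘not∣ true  = refl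
∣sgn-sgn∘not∣ false = refl

module _ {n k} (Mk : Fin k → Fin n → Bool) (a : Fin k → Fin n) (i : Fin n) where

  subMatExt-upper : ∀ x r c → subMatExt Mk x a i (inject₁ r) c ≡ sgn (Mk r (snocRow a i c))
  subMatExt-upper x r c = cong (λ row → sgn (row (snocRow a i c))) (snocRow-inject₁ Mk x r)

  subMatExt-lower : ∀ x c → subMatExt Mk x a i (fromℕ k) c ≡ sgn (x (snocRow a i c))
  subMatExt-lower x c = cong (λ row → sgn (row (snocRow a i c))) (snocRow-last Mk x)

  Per-subMatExt-local : ∀ {x y} → (∀ c → x (snocRow a i c) ≡ y (snocRow a i c)) →
    Per (subMatExt Mk x a i) ≡ Per (subMatExt Mk y a i)
  Per-subMatExt-local {x} {y} agree = Per-cong λ r c → entry r c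
    where
    entry : ∀ r c → subMatExt Mk x a i r c ≡ subMatExt Mk y a i r c
    entry r c with lastView r
    ... | last     = trans (subMatExt-lower x c) (trans (cong sgn (agree c)) (sym (subMatExt-lower y c)))
    ... | inject s = trans (subMatExt-upper x s c) (sym (subMatExt-upper y s c))

  -- Flipping x i changes only the corner entry of M_{A ∪ {i}}, whose minor is M_A.
  Per-flipAt : (∀ j → a j ≢ i) → ∀ x →
    Per (subMatExt Mk x a i) - Per (subMatExt Mk (flipAt i x) a i) ≡ (sgn (x i) - sgn (not (x i))) ℤ.* Per (subMat Mk a)
  Per-flipAt i∉A x = trans (Per-last-entry k M M' upper lower)
    (cong₂ ℤ._*_ (cong₂ _-_ (corner x) (trans (corner (flipAt i x)) (cong sgn (updateAt-updates i x))))
                 (Per-cong λ r c → trans (subMatExt-upper x r (inject₁ c)) (cong (sgn ∘ Mk r) (snocRow-inject₁ a i c))))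
    where
    M = subMatExt Mk x a i
    M' = subMatExt Mk (flipAt i x) a i
    upper : ∀ r c → M (inject₁ r) c ≡ M' (inject₁ r) c
    upper r c = trans (subMatExt-upper x r c) (sym (subMatExt-upper (flipAt i x) r c))
    lower : ∀ c → M (fromℕ k) (inject₁ c) ≡ M' (fromℕ k) (inject₁ c)
    lower c = trans (subMatExt-lower x (inject₁ c))
                    (trans (cong (sgn ∘ x) (snocRow-inject₁ a i c))
                           (sym (trans (subMatExt-lower (flipAt i x) (inject₁ c))
                                       (cong sgn (trans (cong (flipAt i x) (snocRow-inject₁ a i c))
                                                        (updateAt-minimal (a c) i x (i∉A c)))))))
    corner : ∀ y → subMatExt Mk y a i (fromℕ k) (fromℕ k) ≡ sgn (y i)
    corner y = trans (subMatExt-lower y (fromℕ k)) (cong (sgn ∘ y) (snocRow-last a i))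

module _ {n k} (Mk : Fin k → Fin n → Bool) (a : Fin k → Fin n) where

  perA : ℕ
  perA = ℤ.∣ Per (subMat Mk a) ∣

  perExt : Fin n → (Fin n → Bool) → ℕ
  perExt i x = ℤ.∣ Per (subMatExt Mk x a i) ∣

  -- The two permanents differ by ±2 Per(M_A), so they cannot both be smaller than |Per(M_A)|.
  good-or-flipped-good : ∀ i → (∀ j → a j ≢ i) → ∀ x → perA ≤ perExt i x ⊎ perA ≤ perExt i (flipAt i x)
  good-or-flipped-good i i∉A x with perA ≤? perExt i x | perA ≤? perExt i (flipAt i x)
  ... | yes good | _        = inj₁ good
  ... | no _     | yes good = inj₂ good
  ... | no bad   | no bad′  = contradiction (+-mono-< (≰⇒> bad) (≰⇒> bad′)) (≤⇒≯ twice-perA≤)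
    where
    open ≤-Reasoning
    P = Per (subMat Mk a)
    D = sgn (x i) - sgn (not (x i))
    Perₓ = Per (subMatExt Mk x a i)
    Perₓ′ = Per (subMatExt Mk (flipAt i x) a i)
    twice-perA≤ : perA + perA ≤ perExt i x + perExt i (flipAt i x)
    twice-perA≤ = begin
        perA + perA                    ≡⟨ cong (perA +_) (+-identityʳ perA) ⟨
        2 * perA                       ≡⟨ cong (_* perA) (∣sgn-sgn∘not∣ (x i)) ⟨
        ℤ.∣ D ∣ * perA                 ≡⟨ ℤ.∣i*j∣≡∣i∣*∣j∣ D P ⟨
        ℤ.∣ D ℤ.* P ∣                  ≡⟨ cong ℤ.∣_∣ (Per-flipAt Mk a i i∉A x) ⟨
        ℤ.∣ Perₓ - Perₓ′ ∣              ≤⟨ ℤ.∣i-j∣≤∣i∣+∣j∣ Perₓ Perₓ′ ⟩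
        perExt i x + perExt i (flipAt i x) ∎

  isGood : Fin n → (Fin n → Bool) → Bool
  isGood i x = does (perA ≤? perExt i x)

  weight : ℕ → ℕ → Fin n → (Fin n → Bool) → ℕ
  weight α β i x = if isGood i x then α else β

  weight-pairing : ∀ (I : Subset n) → (∀ i → i ∈ I → ∀ j → a j ≢ i) →
    ∀ {α β} → α ≤ β → Pairing I (weight α β) (α + β)
  weight-pairing I I∉A {α} {β} α≤β = record
    { extensional    = λ i x≗y → weight-local i λ c → x≗y (snocRow a i c)
    ; flip-invariant = λ i j j∈I j≢i x →
        weight-local i λ c → updateAt-minimal (snocRow a i c) j x (column≢ i j j∈I j≢i c)
    ; flip-pair-≤    = λ i i∈I x → pair-≤ (good-or-flipped-good i (I∉A i i∈I) x)
    }
    where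
    weight-local : ∀ i {x y} → (∀ c → x (snocRow a i c) ≡ y (snocRow a i c)) → weight α β i x ≡ weight α β i y
    weight-local i agree = cong (λ v → if does (perA ≤? ℤ.∣ v ∣) then α else β) (Per-subMatExt-local Mk a i agree)
    column≢ : ∀ i j → j ∈ I → j ≢ i → ∀ c → snocRow a i c ≢ j
    column≢ i j j∈I j≢i c with lastView c
    ... | last     = λ e → j≢i (trans (sym e) (snocRow-last a i))
    ... | inject r = λ e → I∉A j j∈I r (trans (sym (snocRow-inject₁ a i r)) e)
    pair-≤ : ∀ {i x y} → perA ≤ perExt i x ⊎ perA ≤ perExt i y → weight α β i x + weight α β i y ≤ α + β
    pair-≤ {i} {x} {y} (inj₁ good) rewrite dec-true (perA ≤? perExt i x) good with isGood i y
    ... | true  = +-monoʳ-≤ α α≤β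
    ... | false = ≤-refl
    pair-≤ {i} {x} {y} (inj₂ good) rewrite dec-true (perA ≤? perExt i y) good with isGood i x
    ... | true  = +-monoʳ-≤ α α≤β
    ... | false = ≤-reflexive (+-comm β α)

countIn : ∀ {n} → Subset n → (Fin n → Bool) → ℕ
countIn []            q = 0
countIn (inside ∷ I)  q = (if q zero then 1 else 0) + countIn I (q ∘ suc)
countIn (outside ∷ I) q = countIn I (q ∘ suc)

∣I∣≡countIn+countIn∘not : ∀ {n} (I : Subset n) q → ∣ I ∣ ≡ countIn I q + countIn I (not ∘ q)
∣I∣≡countIn+countIn∘not []            q = refl
∣I∣≡countIn+countIn∘not (outside ∷ I) q = ∣I∣≡countIn+countIn∘not I (q ∘ suc)
∣I∣≡countIn+countIn∘not (inside ∷ I)  q with q zero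
... | true  = cong suc (∣I∣≡countIn+countIn∘not I (q ∘ suc))
... | false = trans (cong suc (∣I∣≡countIn+countIn∘not I (q ∘ suc))) (sym (+-suc _ _))

prodOver-if : ∀ {n} (I : Subset n) q α β →
  ∏[ i ∈ I ] (if q i then α else β) ≡ α ^ countIn I q * β ^ countIn I (not ∘ q)
prodOver-if []            q α β = refl
prodOver-if (outside ∷ I) q α β = prodOver-if I (q ∘ suc) α β
prodOver-if (inside ∷ I)  q α β with q zero
... | true  = trans (cong (α *_) (prodOver-if I (q ∘ suc) α β)) (sym (*-assoc α _ _))
... | false = trans (cong (β *_) (prodOver-if I (q ∘ suc) α β)) (x*[y*z]≡y*[x*z] β (α ^ countIn I (q ∘ suc)) _)
  where x*[y*z]≡y*[x*z] : ∀ x y z → x * (y * z) ≡ y * (x * z)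
        x*[y*z]≡y*[x*z] = solve-∀

length-filter : ∀ {X : Set} {p} {P : Pred X p} (P? : Decidable P) xs →
  length (filter P? xs) ≡ ∑[ x ∈ xs ] when (does (P? x)) 1
length-filter P? []       = refl
length-filter P? (x ∷ xs) with does (P? x)
... | true  = cong suc (length-filter P? xs)
... | false = length-filter P? xs

∑-allFin-countIn : ∀ {n} (I : Subset n) (q : Fin n → Bool) →
  ∑[ i ∈ allFin n ] when (does (i ∈? I) ∧ q i) 1 ≡ countIn I q
∑-allFin-countIn []            q = refl
∑-allFin-countIn {suc n} (b ∷ I) q =
  trans (∑-allFin-suc n (λ i → when (does (i ∈? b ∷ I) ∧ q i) 1)) (head-case b)
  where
  head-case : ∀ b → when (does (zero ∈? b ∷ I) ∧ q zero) 1
                      + ∑[ i ∈ allFin n ] when (does (i ∈? I) ∧ q (suc i)) 1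
                    ≡ countIn (b ∷ I) q
  head-case true  = cong (_ +_) (∑-allFin-countIn I (q ∘ suc))
  head-case false = ∑-allFin-countIn I (q ∘ suc)

goodCount≡countIn : ∀ {n k} (Mk : Fin k → Fin n → Bool) (a : Fin k → Fin n) (I : Subset n) x →
  goodCount Mk a I x ≡ countIn I (λ i → isGood Mk a i x)
goodCount≡countIn {n} Mk a I x =
  trans (length-filter (good? Mk a I x) (allFin n)) (∑-allFin-countIn I (λ i → isGood Mk a i x))

countRows≡∑ : ∀ {n} {P : (Fin n → Bool) → Set} (P? : Decidable P) →
  countRows P? ≡ ∑[ x ∈ allRows n ] when (does (P? x)) 1
countRows≡∑ {n} P? = length-filter P? (allRows n)

*-when-≤ : ∀ {p} {P : Set p} (P? : Dec P) {c w} → (P → c * 1 ≤ w) → c * when (does P?) 1 ≤ w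
*-when-≤ (yes p)     c≤w = c≤w p
*-when-≤ (no _) {c} {w} c≤w = subst (_≤ w) (sym (*-zeroʳ c)) z≤n

^-distribʳ-* : ∀ a b m → (a * b) ^ m ≡ a ^ m * b ^ m
^-distribʳ-* a b zero    = refl
^-distribʳ-* a b (suc m) = trans (cong (a * b *_) (^-distribʳ-* a b m)) (interchange a b (a ^ m) (b ^ m))
  where interchange : ∀ a b c d → a * b * (c * d) ≡ a * c * (b * d)
        interchange = solve-∀

*-complement-≤ : ∀ q s t N → s + t ≡ N → q * t ≤ N → (q ∸ 1) * N ≤ q * s
*-complement-≤ q s t N s+t≡N qt≤N = begin
    (q ∸ 1) * N      ≡⟨ *-distribʳ-∸ N q 1 ⟩
    q * N ∸ 1 * N    ≡⟨ cong (q * N ∸_) (*-identityˡ N) ⟩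
    q * N ∸ N        ≤⟨ ∸-monoʳ-≤ (q * N) qt≤N ⟩
    q * N ∸ q * t    ≡⟨ cong (λ z → q * z ∸ q * t) s+t≡N ⟨
    q * (s + t) ∸ q * t ≡⟨ cong (_∸ q * t) (*-distribˡ-+ q s t) ⟩
    q * s + q * t ∸ q * t ≡⟨ m+n∸n≡m (q * s) (q * t) ⟩
    q * s ∎
  where open ≤-Reasoning

100^[c+d]≤64^c*125^d : ∀ c d → 2 * c ≤ d → 100 ^ (c + d) ≤ 64 ^ c * 125 ^ d
100^[c+d]≤64^c*125^d c d 2c≤d with m≤n⇒∃[o]m+o≡n 2c≤d
... | e , refl = go c
  where
  open ≤-Reasoning
  go : ∀ c → 100 ^ (c + (2 * c + e)) ≤ 64 ^ c * 125 ^ (2 * c + e)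
  go zero    = ≤-trans (^-monoˡ-≤ e (m≤m+n 100 25)) (≤-reflexive (sym (+-identityʳ _)))
  go (suc c) = begin
      100 ^ (suc c + (2 * suc c + e))       ≡⟨ cong (100 ^_) (exponent c e) ⟩
      100 ^ (3 + (c + (2 * c + e)))         ≡⟨ ^-distribˡ-+-* 100 3 (c + (2 * c + e)) ⟩
      1000000 * 100 ^ (c + (2 * c + e))     ≤⟨ *-monoʳ-≤ 1000000 (go c) ⟩
      1000000 * (64 ^ c * 125 ^ (2 * c + e)) ≡⟨ regroup (64 ^ c) (125 ^ (2 * c + e)) ⟩
      64 ^ suc c * 125 ^ (2 + (2 * c + e))  ≡⟨ cong (λ z → 64 ^ suc c * 125 ^ z) (sym (exponent′ c e)) ⟩
      64 ^ suc c * 125 ^ (2 * suc c + e)    ∎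
    where
    exponent : ∀ c e → suc c + (2 * suc c + e) ≡ 3 + (c + (2 * c + e))
    exponent = solve-∀
    exponent′ : ∀ c e → 2 * suc c + e ≡ 2 + (2 * c + e)
    exponent′ = solve-∀
    regroup : ∀ x y → 64 * (125 * 125) * (x * y) ≡ 64 * x * (125 * (125 * y))
    regroup x y = interchange 64 125 x y
      where interchange : ∀ a b x y → a * (b * b) * (x * y) ≡ a * x * (b * (b * y))
            interchange = solve-∀

module _ {n k} (Mk : Fin k → Fin n → Bool) (a : Fin k → Fin n) (I : Subset n)
         (I∉A : ∀ i → i ∈ I → ∀ j → a j ≢ i) where

  some-good-bound : (2 ^ ∣ I ∣ ∸ 1) * 2 ^ n ≤ 2 ^ ∣ I ∣ * countRows (λ x → 1 ≤? goodCount Mk a I x)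
  some-good-bound = subst (λ c → (2 ^ ∣ I ∣ ∸ 1) * 2 ^ n ≤ 2 ^ ∣ I ∣ * c)
                          (sym (countRows≡∑ (λ x → 1 ≤? goodCount Mk a I x)))
                          (*-complement-≤ (2 ^ ∣ I ∣) (∑ (allRows n) some) (∑ (allRows n) none) (2 ^ n)
                                          total none-bound)
    where
    some none : (Fin n → Bool) → ℕ
    some x = when (does (1 ≤? goodCount Mk a I x)) 1
    none x = ∏[ i ∈ I ] weight Mk a 0 1 i x
    some+none≡1 : ∀ x → some x + none x ≡ 1
    some+none≡1 x rewrite goodCount≡countIn Mk a I x | prodOver-if I (λ i → isGood Mk a i x) 0 1
      with countIn I (λ i → isGood Mk a i x)
    ... | zero  = trans (*-identityˡ (1 ^ b)) (^-zeroˡ b)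
      where b = countIn I (not ∘ λ i → isGood Mk a i x)
    ... | suc _ = refl
    total : ∑ (allRows n) some + ∑ (allRows n) none ≡ 2 ^ n
    total = trans (sym (∑-distrib-+ (allRows n) some none)) (trans (∑-cong (allRows n) some+none≡1) (∑-allRows-1 n))
    none-bound : 2 ^ ∣ I ∣ * ∑ (allRows n) none ≤ 2 ^ n
    none-bound = subst (2 ^ ∣ I ∣ * ∑ (allRows n) none ≤_)
                       (trans (cong (2 ^ n *_) (^-zeroˡ ∣ I ∣)) (*-identityʳ _))
                       (pairing-bound I (weight-pairing Mk a I I∉A z≤n))

  few-good-bound :
    countRows (λ x → ¬? (∣ I ∣ ≤? 3 * goodCount Mk a I x)) * 200 ^ ∣ I ∣ ≤ 1 * 189 ^ ∣ I ∣ * 2 ^ n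
  few-good-bound = begin
      countRows few? * 200 ^ m
    ≡⟨ cong₂ _*_ (countRows≡∑ few?) (^-distribʳ-* 2 100 m) ⟩
      ∑ (allRows n) few * (2 ^ m * 100 ^ m)
    ≡⟨ regroup (∑ (allRows n) few) (2 ^ m) (100 ^ m) ⟩
      2 ^ m * (100 ^ m * ∑ (allRows n) few)
    ≡⟨ cong (2 ^ m *_) (*-distribˡ-∑ (100 ^ m) (allRows n) few) ⟩
      2 ^ m * ∑[ x ∈ allRows n ] (100 ^ m * few x)
    ≤⟨ *-monoʳ-≤ (2 ^ m) (∑-mono-≤ (allRows n) few≤W) ⟩
      2 ^ m * ∑ (allRows n) W
    ≤⟨ pairing-bound I (weight-pairing Mk a I I∉A (m≤m+n 64 61)) ⟩
      2 ^ n * 189 ^ m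
    ≡⟨ swap (2 ^ n) (189 ^ m) ⟩
      1 * 189 ^ m * 2 ^ n ∎
    where
    open ≤-Reasoning
    m = ∣ I ∣
    few? : Decidable (λ x → ¬ (m ≤ 3 * goodCount Mk a I x))
    few? x = ¬? (m ≤? 3 * goodCount Mk a I x)
    few W : (Fin n → Bool) → ℕ
    few x = when (does (few? x)) 1
    W x = ∏[ i ∈ I ] weight Mk a 64 125 i x
    regroup : ∀ s x y → s * (x * y) ≡ x * (y * s)
    regroup = solve-∀
    swap : ∀ x y → x * y ≡ 1 * y * x
    swap = solve-∀
    few⇒100^m≤W : ∀ x → ¬ (m ≤ 3 * goodCount Mk a I x) → 100 ^ m * 1 ≤ W x
    few⇒100^m≤W x ¬m≤3g = subst₂ _≤_ (sym (trans (*-identityʳ (100 ^ m)) (cong (100 ^_) m≡g+b)))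
                                 (sym (prodOver-if I (λ i → isGood Mk a i x) 64 125))
                                 (100^[c+d]≤64^c*125^d g b 2g≤b)
      where
      g = countIn I (λ i → isGood Mk a i x)
      b = countIn I (λ i → not (isGood Mk a i x))
      m≡g+b : m ≡ g + b
      m≡g+b = ∣I∣≡countIn+countIn∘not I (λ i → isGood Mk a i x)
      3*c≡c+2*c : ∀ c → 3 * c ≡ c + 2 * c
      3*c≡c+2*c = solve-∀
      3g<m : 3 * g < m
      3g<m = subst (λ c → 3 * c < m) (goodCount≡countIn Mk a I x) (≰⇒> ¬m≤3g)
      2g≤b : 2 * g ≤ b
      2g≤b = <⇒≤ (+-cancelˡ-< g (2 * g) b (subst₂ _<_ (3*c≡c+2*c g) m≡g+b 3g<m))
    few≤W : ∀ x → 100 ^ m * when (does (few? x)) 1 ≤ W x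
    few≤W x = *-when-≤ (few? x) {100 ^ m} (few⇒100^m≤W x)

lemma4p2 :
    Σ ℕ (λ C → Σ ℕ (λ p → Σ ℕ (λ q → p < q ×
      ((n k : ℕ) → 1 ≤ k → k < n →
       (a : Fin k → Fin n) → StrictlyIncreasing a →
       (I : Subset n) → (∀ i → i ∈ I → ∀ j → a j ≢ i) →
       (Mk : Fin k → Fin n → Bool) →
         (((2 ^ ∣ I ∣) ∸ 1) * (2 ^ n)
            ≤ (2 ^ ∣ I ∣) * countRows (λ x → 1 ≤? goodCount Mk a I x))
         ×
         (countRows (λ x → ¬? (∣ I ∣ ≤? 3 * goodCount Mk a I x)) * (q ^ ∣ I ∣)
            ≤ C * (p ^ ∣ I ∣) * (2 ^ n))))))
lemma4p2 = 1 , 189 , 200 , m≤m+n 190 10 ,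
  λ n k _ _ a _ I I∉A Mk → some-good-bound Mk a I I∉A , few-good-bound Mk a I I∉A
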